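{- Let $a,m\ge 1$ be integers, and let $\mathrm{scp}_{a,m}(n)$ denote the number of self-conjugate $(a,a,m)$-copartitions of size $n$. Then, as formal power series in $q$, $$\sum_{n=0}^\infty \mathrm{scp}_{a,m}(n)\,q^n=(-q^{m+2a};q^{2m})_\infty .$$
   Context: For integers $a,b,m\ge1$, an $(a,b,m)$-copartition is a triple of integer partitions $(\gamma,\rho,\sigma)$ such that every part of $\gamma$ is $\ge a$ and $\equiv a \pmod m$, every part of $\sigma$ is $\ge b$ and $\equiv b\pmod m$, and $\rho$ has exactly as many parts as $\sigma$, each part of $\rho$ being equal to $m$ times the number of parts of $\gamma$. Its size is the sum of all parts of $\gamma$, $\rho$ and $\sigma$. Writing $\nu(\lambda)$ for the number of parts of a partition $\lambda$, the conjugate of the $(a,b,m)$-copartition $(\gamma,\rho,\sigma)$ is the $(b,a,m)$-copartition $(\sigma,\rho',\gamma)$, where $\rho'$ consists of exactly $\nu(\gamma)$ parts each equal to $m\,\nu(\sigma)$. An $(a,a,m)$-copartition is self-conjugate if it equals its conjugate. Notation: $(x;q)_\infty=\prod_{k\ge0}(1-xq^k)$. -}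

module Defs where

open import Data.Nat using (ℕ; zero; suc; _≤_; _∸_; _≡ᵇ_) renaming (_+_ to _+ℕ_; _*_ to _*ℕ_)
open import Data.Nat.Divisibility using (_∣_)
open import Data.Integer using (ℤ; _+_; _*_; _-_; -_; 0ℤ; 1ℤ)
open import Data.Bool using (if_then_else_)
open import Data.List using (List; length; replicate)
open import Data.Nat.ListAction using (sum)
open import Data.List.Relation.Unary.All using (All)
open import Data.List.Relation.Unary.Linked using (Linked)
open import Data.Product using (Σ; _×_; _,_)
open import Relation.Binary.PropositionalEquality using (_≡_)

IsPartition : List ℕ → Set
IsPartition xs = Linked (λ x y → y ≤ x) xs × All (λ x → 1 ≤ x) xs

-- number of parts ν(λ) is `length`, size is `sum`.

PartOk : ℕ → ℕ → ℕ → Set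
PartOk r m x = r ≤ x × m ∣ (x ∸ r)

Triple : Set
Triple = List ℕ × List ℕ × List ℕ

IsCopartition : ℕ → ℕ → ℕ → Triple → Set
IsCopartition a b m (γ , ρ , σ) =
  IsPartition γ × IsPartition ρ × IsPartition σ ×
  All (PartOk a m) γ × All (PartOk b m) σ ×
  ρ ≡ replicate (length σ) (m *ℕ length γ)

size : Triple → ℕ
size (γ , ρ , σ) = sum γ +ℕ sum ρ +ℕ sum σ

conjugate : ℕ → Triple → Triple
conjugate m (γ , ρ , σ) = (σ , replicate (length γ) (m *ℕ length σ) , γ)

SCP : ℕ → ℕ → ℕ → Set
SCP a m n = Σ Triple λ t →
  IsCopartition a a m t × conjugate m t ≡ t × size t ≡ n

Series : Set
Series = ℕ → ℤ

sumTo : (ℕ → ℤ) → ℕ → ℤ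
sumTo f zero = 0ℤ
sumTo f (suc n) = sumTo f n + f n

one : Series
one zero = 1ℤ
one (suc n) = 0ℤ

mono : ℕ → Series
mono k n = if k ≡ᵇ n then 1ℤ else 0ℤ

_⊗_ : Series → Series → Series
(f ⊗ g) n = sumTo (λ i → f i * g (n ∸ i)) (suc n)

_⊖_ : Series → Series → Series
(f ⊖ g) n = f n - g n

neg : Series → Series
neg f n = - f n

pow : Series → ℕ → Series
pow s zero = one
pow s (suc k) = s ⊗ pow s k

prodTo : (ℕ → Series) → ℕ → Series
prodTo F zero = one
prodTo F (suc N) = prodTo F N ⊗ F N

-- (x;q)_∞ = ∏_{k≥0} (1 - x q^k), for q with zero constant term:
-- the factors with k > n are ≡ 1 mod q^{n+1}, so the n-th coefficient
-- of the infinite product is the n-th coefficient of ∏_{k ≤ n}.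
poch∞ : Series → Series → Series
poch∞ x q n = prodTo (λ k → one ⊖ (x ⊗ pow q k)) (suc n) n

{-# OPTIONS --safe #-}
module Submission where

-- A self-conjugate copartition is determined by γ (σ = γ, and ρ has ν(γ) parts equal to m ν(γ)),
-- and its size is 2|γ| + m ν(γ)². Write γ = (γ₀ ≥ … ≥ γₖ₋₁) as γᵢ = a + m tᵢ and add the
-- staircase eᵢ = tᵢ + (k − 1 − i): this turns the non-increasing list t into a strictly
-- decreasing list e and the size into Σᵢ (m + 2a + 2m eᵢ), because m k² = Σᵢ m (2(k − 1 − i) + 1).
-- So self-conjugate copartitions of n are partitions of n into distinct parts from
-- m + 2a + 2mℕ, which is what the coefficient of qⁿ in ∏ₖ (1 + q^(m+2a+2mk)) counts.

open import Defs
open import Axiom.UniquenessOfIdentityProofs using (module Decidable⇒UIP)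
open import Data.Bool using (true; false)
open import Data.Empty using (⊥-elim)
open import Data.Fin using (Fin; zero)
open import Data.Fin.Properties using (+↔⊎)
open import Data.Integer as ℤ using (ℤ; +_; 0ℤ; 1ℤ)
import Data.Integer.Properties as ℤₚ
open import Algebra.Properties.CommutativeSemigroup ℤₚ.+-commutativeSemigroup using (interchange)
open import Data.List using (List; []; _∷_; map; length; replicate)
import Data.List.Properties as Listₚ
open import Data.List.Relation.Unary.All as All using (All; []; _∷_)
open import Data.List.Relation.Unary.All.Properties using (replicate⁺)
open import Data.List.Relation.Unary.Linked as Linked using (Linked; []; [-]; _∷_)
open import Data.List.Relation.Unary.Linked.Properties using (Linked⇒All; map⁺; map⁻)
open import Data.Nat using (ℕ; zero; suc; _+_; _*_; _∸_; _≤_; _<_; _≥_; _>_; _≡ᵇ_; z≤n; s≤s; NonZero; >-nonZero⁻¹)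
open import Data.Nat.Properties
open import Data.Nat.Divisibility using (_∣_; divides)
open import Data.Nat.ListAction using (sum)
open import Data.Nat.Solver using (module +-*-Solver)
open import Data.Product using (Σ; _×_; _,_; proj₁; proj₂)
import Data.Product.Properties as Productₚ
open import Data.Sum using (_⊎_; inj₁; inj₂)
open import Data.Sum.Function.Propositional using (_⊎-↔_)
open import Function using (_∘_)
open import Function.Bundles using (_↔_; mk↔ₛ′)
open import Function.Properties.Inverse using (↔-trans; ↔-sym)
open import Relation.Binary.PropositionalEquality
open import Relation.Nullary using (Dec; yes; no; ¬_)
open import Relation.Nullary.Irrelevant using (Irrelevant)

-- Unlike if does p then … else …, this is stuck on the Dec itself, so `with p` can unblock it.
if?_then_else_ : {P A : Set} → Dec P → A → A → A
if? yes _ then x else _ = x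
if? no _  then _ else y = y

if?-float : {P A B : Set} (f : A → B) (p : Dec P) {x y : A} →
            f (if? p then x else y) ≡ (if? p then f x else f y)
if?-float f (yes _) = refl
if?-float f (no _)  = refl

infixr 2 _×-irrelevant_

_×-irrelevant_ : {A B : Set} → Irrelevant A → Irrelevant B → Irrelevant (A × B)
(irrA ×-irrelevant irrB) (x , y) (x′ , y′) = cong₂ _,_ (irrA x x′) (irrB y y′)

Σ-≡-proj₁ : {A : Set} {P : A → Set} → (∀ x → Irrelevant (P x)) →
            {p q : Σ A P} → proj₁ p ≡ proj₁ q → p ≡ q
Σ-≡-proj₁ irr {x , p} {.x , q} refl = cong (x ,_) (irr x p q)

∣-irrelevant : ∀ {m n} .{{_ : NonZero m}} → Irrelevant (m ∣ n)
∣-irrelevant {m} (divides q eq) (divides q′ eq′)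
  with *-cancelʳ-≡ q q′ m (trans (sym eq) eq′)
... | refl = cong (divides q) (≡-irrelevant eq eq′)

List-≡-irrelevant : {xs ys : List ℕ} → Irrelevant (xs ≡ ys)
List-≡-irrelevant = Decidable⇒UIP.≡-irrelevant (Listₚ.≡-dec _≟_)

Triple-≡-irrelevant : {s t : Triple} → Irrelevant (s ≡ t)
Triple-≡-irrelevant = Decidable⇒UIP.≡-irrelevant
  (Productₚ.≡-dec (Listₚ.≡-dec _≟_) (Productₚ.≡-dec (Listₚ.≡-dec _≟_) (Listₚ.≡-dec _≟_)))

IsPartition-irrelevant : ∀ {γ} → Irrelevant (IsPartition γ)
IsPartition-irrelevant = Linked.irrelevant ≤-irrelevant ×-irrelevant All.irrelevant ≤-irrelevant

PartOk-irrelevant : ∀ {r m x} .{{_ : NonZero m}} → Irrelevant (PartOk r m x)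
PartOk-irrelevant = ≤-irrelevant ×-irrelevant ∣-irrelevant

IsCopartition-irrelevant : ∀ {a b m} .{{_ : NonZero m}} t → Irrelevant (IsCopartition a b m t)
IsCopartition-irrelevant _ =
  IsPartition-irrelevant ×-irrelevant IsPartition-irrelevant ×-irrelevant IsPartition-irrelevant ×-irrelevant
  All.irrelevant PartOk-irrelevant ×-irrelevant All.irrelevant PartOk-irrelevant ×-irrelevant List-≡-irrelevant

-- Coefficients of series

sumTo-cong : ∀ {f g : ℕ → ℤ} L → (∀ {i} → i < L → f i ≡ g i) → sumTo f L ≡ sumTo g L
sumTo-cong zero    f≡g = refl
sumTo-cong (suc L) f≡g = cong₂ ℤ._+_ (sumTo-cong L (f≡g ∘ m<n⇒m<1+n)) (f≡g (n<1+n L))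

sumTo-zero : ∀ {f : ℕ → ℤ} L → (∀ {i} → i < L → f i ≡ 0ℤ) → sumTo f L ≡ 0ℤ
sumTo-zero zero    f≡0 = refl
sumTo-zero (suc L) f≡0 = cong₂ ℤ._+_ (sumTo-zero L (f≡0 ∘ m<n⇒m<1+n)) (f≡0 (n<1+n L))

sumTo-single : ∀ {f : ℕ → ℤ} L {j} → j < L → (∀ {i} → i < L → i ≢ j → f i ≡ 0ℤ) →
               sumTo f L ≡ f j
sumTo-single {f} (suc L) {j} j<1+L others with j ≟ L
... | yes refl = begin
  sumTo f L ℤ.+ f L
    ≡⟨ cong (ℤ._+ f L) (sumTo-zero L (λ i<L → others (m<n⇒m<1+n i<L) (<⇒≢ i<L))) ⟩
  0ℤ ℤ.+ f L        ≡⟨ ℤₚ.+-identityˡ (f L) ⟩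
  f L               ∎
  where open ≡-Reasoning
... | no j≢L = begin
  sumTo f L ℤ.+ f L
    ≡⟨ cong₂ ℤ._+_ (sumTo-single L j<L (others ∘ m<n⇒m<1+n)) (others (n<1+n L) (j≢L ∘ sym)) ⟩
  f j ℤ.+ 0ℤ        ≡⟨ ℤₚ.+-identityʳ (f j) ⟩
  f j               ∎
  where open ≡-Reasoning
        j<L = ≤∧≢⇒< (≤-pred j<1+L) j≢L

sumTo-+ : ∀ (f g : ℕ → ℤ) L → sumTo (λ i → f i ℤ.+ g i) L ≡ sumTo f L ℤ.+ sumTo g L
sumTo-+ f g zero    = refl
sumTo-+ f g (suc L) = trans (cong (ℤ._+ (f L ℤ.+ g L)) (sumTo-+ f g L))
                            (interchange (sumTo f L) (sumTo g L) (f L) (g L))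

mono-≡ : ∀ {s i} → s ≡ i → mono s i ≡ 1ℤ
mono-≡ {s} refl with s ≡ᵇ s | ≡⇒≡ᵇ s s refl
... | true | _ = refl

mono-≢ : ∀ {s i} → s ≢ i → mono s i ≡ 0ℤ
mono-≢ {s} {i} s≢i with s ≡ᵇ i | ≡ᵇ⇒≡ s i
... | false | _    = refl
... | true  | s≡i = ⊥-elim (s≢i (s≡i _))

one≗mono0 : one ≗ mono 0
one≗mono0 zero    = refl
one≗mono0 (suc j) = refl

⊗-congʳ : ∀ f {g h : Series} → g ≗ h → f ⊗ g ≗ f ⊗ h
⊗-congʳ f g≗h j = sumTo-cong (suc j) (λ {i} _ → cong (f i ℤ.*_) (g≗h (j ∸ i)))

⊗-distribˡ-+ : ∀ f g h j → (f ⊗ (λ i → g i ℤ.+ h i)) j ≡ (f ⊗ g) j ℤ.+ (f ⊗ h) j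
⊗-distribˡ-+ f g h j = trans
  (sumTo-cong (suc j) (λ {i} _ → ℤₚ.*-distribˡ-+ (f i) (g (j ∸ i)) (h (j ∸ i))))
  (sumTo-+ _ _ (suc j))

⊗-mono : ∀ f t j → (f ⊗ mono t) j ≡ (if? (t ≤? j) then f (j ∸ t) else 0ℤ)
⊗-mono f t j with t ≤? j
... | yes t≤j = begin
  sumTo (λ i → f i ℤ.* mono t (j ∸ i)) (suc j)
    ≡⟨ sumTo-single (suc j) (s≤s (m∸n≤m j t)) (λ {i} i<1+j i≢j∸t →
         trans (cong (f i ℤ.*_) (mono-≢ (i≢j∸t ∘ i≡j∸t (≤-pred i<1+j)))) (ℤₚ.*-zeroʳ (f i))) ⟩
  f (j ∸ t) ℤ.* mono t (j ∸ (j ∸ t))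
    ≡⟨ cong (f (j ∸ t) ℤ.*_) (mono-≡ (sym (m∸[m∸n]≡n t≤j))) ⟩
  f (j ∸ t) ℤ.* 1ℤ
    ≡⟨ ℤₚ.*-identityʳ (f (j ∸ t)) ⟩
  f (j ∸ t) ∎
  where
  open ≡-Reasoning
  i≡j∸t : ∀ {i} → i ≤ j → t ≡ j ∸ i → i ≡ j ∸ t
  i≡j∸t i≤j t≡j∸i = trans (sym (m∸[m∸n]≡n i≤j)) (cong (j ∸_) (sym t≡j∸i))
... | no t≰j = sumTo-zero (suc j) (λ {i} _ →
  trans (cong (f i ℤ.*_) (mono-≢ (λ t≡j∸i → t≰j (subst (_≤ j) (sym t≡j∸i) (m∸n≤m j i)))))
        (ℤₚ.*-zeroʳ (f i)))

mono-shift : ∀ s t j → (if? (t ≤? j) then mono s (j ∸ t) else 0ℤ) ≡ mono (s + t) j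
mono-shift s t j with t ≤? j
... | no t≰j = sym (mono-≢ (λ s+t≡j → t≰j (subst (t ≤_) s+t≡j (m≤n+m t s))))
... | yes t≤j with s ≟ j ∸ t
...   | yes s≡j∸t = trans (mono-≡ s≡j∸t)
                          (sym (mono-≡ (trans (cong (_+ t) s≡j∸t) (m∸n+n≡m t≤j))))
...   | no s≢j∸t  = trans (mono-≢ s≢j∸t) (sym (mono-≢ (s≢j∸t ∘ s≡j∸t)))
  where s≡j∸t : s + t ≡ j → s ≡ j ∸ t
        s≡j∸t s+t≡j = trans (sym (m+n∸n≡m s t)) (cong (_∸ t) s+t≡j)

pow-mono : ∀ d k → pow (mono d) k ≗ mono (d * k)
pow-mono d zero    j = trans (one≗mono0 j) (cong (λ e → mono e j) (sym (*-zeroʳ d)))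
pow-mono d (suc k) j = begin
  (mono d ⊗ pow (mono d) k) j ≡⟨ ⊗-congʳ (mono d) (pow-mono d k) j ⟩
  (mono d ⊗ mono (d * k)) j   ≡⟨ ⊗-mono (mono d) (d * k) j ⟩
  _                           ≡⟨ mono-shift d (d * k) j ⟩
  mono (d + d * k) j          ≡⟨ cong (λ e → mono e j) (sym (*-suc d k)) ⟩
  mono (d * suc k) j          ∎
  where open ≡-Reasoning

-- poch∞ (neg (mono b)) (mono d) n unfolds to prodTo (factor b d) (suc n) n.
factor : ℕ → ℕ → ℕ → Series
factor b d k = one ⊖ (neg (mono b) ⊗ pow (mono d) k)

factor-coeff : ∀ b d k → factor b d k ≗ (λ j → one j ℤ.+ mono (b + d * k) j)
factor-coeff b d k j = cong (λ x → one j ℤ.+ x) (begin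
  ℤ.- (neg (mono b) ⊗ pow (mono d) k) j
    ≡⟨ cong ℤ.-_ (⊗-congʳ (neg (mono b)) (pow-mono d k) j) ⟩
  ℤ.- (neg (mono b) ⊗ mono (d * k)) j
    ≡⟨ cong ℤ.-_ (⊗-mono (neg (mono b)) (d * k) j) ⟩
  ℤ.- (if? (d * k ≤? j) then ℤ.- mono b (j ∸ d * k) else 0ℤ)
    ≡⟨ cong ℤ.-_ (sym (if?-float ℤ.-_ (d * k ≤? j))) ⟩
  ℤ.- ℤ.- (if? (d * k ≤? j) then mono b (j ∸ d * k) else 0ℤ)
    ≡⟨ ℤₚ.neg-involutive _ ⟩
  (if? (d * k ≤? j) then mono b (j ∸ d * k) else 0ℤ)
    ≡⟨ mono-shift b (d * k) j ⟩
  mono (b + d * k) j ∎)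
  where open ≡-Reasoning

-- Partitions into distinct parts of a weighted index set

Strict : List ℕ → Set
Strict = Linked _>_

NonIncreasing : List ℕ → Set
NonIncreasing = Linked _≥_

strict-below : ∀ {e es} → Strict (e ∷ es) → All (_< e) es
strict-below [-]             = []
strict-below (e>e′ ∷ strict) = Linked⇒All (λ x>y y>z → <-trans y>z x>y) e>e′ strict

strict-cons : ∀ {e es} → All (_< e) es → Strict es → Strict (e ∷ es)
strict-cons []          []     = [-]
strict-cons (e′<e ∷ _) strict = e′<e ∷ strict

strict-length : ∀ {e es} → Strict (e ∷ es) → length es ≤ e
strict-length [-]             = z≤n
strict-length (e′<e ∷ strict) = ≤-trans (s≤s (strict-length strict)) e′<e

All-≤-sum-map : ∀ (f : ℕ → ℕ) es → All (λ e → f e ≤ sum (map f es)) es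
All-≤-sum-map f []       = []
All-≤-sum-map f (e ∷ es) =
  m≤m+n (f e) _ ∷ All.map (λ le → ≤-trans le (m≤n+m _ (f e))) (All-≤-sum-map f es)

Fin-if-↔ : ∀ {P X : Set} (p : Dec P) {c} → Irrelevant P → Fin c ↔ X →
           Fin (if? p then c else 0) ↔ (P × X)
Fin-if-↔ (yes p) irr c↔X =
  ↔-trans c↔X (mk↔ₛ′ (p ,_) proj₂ (λ { (q , x) → cong (_, x) (irr p q) }) (λ _ → refl))
Fin-if-↔ (no ¬p) _ _ = mk↔ₛ′ (λ ()) (⊥-elim ∘ ¬p ∘ proj₁) (⊥-elim ∘ ¬p ∘ proj₁) (λ ())

module DistinctParts (w : ℕ → ℕ) where

  DistinctParts : ℕ → ℕ → Set
  DistinctParts N n = Σ (List ℕ) λ es → Strict es × All (_< N) es × sum (map w es) ≡ n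

  DistinctParts-≡ : ∀ {N n} {p q : DistinctParts N n} → proj₁ p ≡ proj₁ q → p ≡ q
  DistinctParts-≡ = Σ-≡-proj₁ λ _ →
    Linked.irrelevant <-irrelevant ×-irrelevant All.irrelevant <-irrelevant ×-irrelevant ≡-irrelevant

  distinctCount : ℕ → ℕ → ℕ
  distinctCount zero    zero    = 1
  distinctCount zero    (suc n) = 0
  distinctCount (suc N) n       =
    distinctCount N n + (if? (w N ≤? n) then distinctCount N (n ∸ w N) else 0)

  DistinctParts-suc-↔ : ∀ N n → DistinctParts (suc N) n ↔
                        (DistinctParts N n ⊎ (w N ≤ n × DistinctParts N (n ∸ w N)))
  DistinctParts-suc-↔ N n = mk↔ₛ′ split join split∘join join∘split
    where
    split : DistinctParts (suc N) n → DistinctParts N n ⊎ (w N ≤ n × DistinctParts N (n ∸ w N))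
    split ([] , strict , [] , Σ≡n) = inj₁ ([] , strict , [] , Σ≡n)
    split (e ∷ es , strict , e<1+N ∷ _ , Σ≡n) with e ≟ N
    ... | yes refl = inj₂ (subst (w N ≤_) Σ≡n (m≤m+n (w N) _) ,
                           es , Linked.tail strict , strict-below strict ,
                           trans (sym (m+n∸m≡n (w N) _)) (cong (_∸ w N) Σ≡n))
    ... | no e≢N   = inj₁ (e ∷ es , strict ,
                           e<N ∷ All.map (λ x<e → <-trans x<e e<N) (strict-below strict) , Σ≡n)
      where e<N = ≤∧≢⇒< (≤-pred e<1+N) e≢N

    join : DistinctParts N n ⊎ (w N ≤ n × DistinctParts N (n ∸ w N)) → DistinctParts (suc N) n
    join (inj₁ (es , strict , bounded , Σ≡n)) = es , strict , All.map m<n⇒m<1+n bounded , Σ≡n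
    join (inj₂ (wN≤n , es , strict , bounded , Σ≡n∸wN)) =
      N ∷ es , strict-cons bounded strict , n<1+n N ∷ All.map m<n⇒m<1+n bounded ,
      trans (cong (_+_ (w N)) Σ≡n∸wN) (m+[n∸m]≡n wN≤n)

    split∘join : ∀ s → split (join s) ≡ s
    split∘join (inj₁ ([] , _ , [] , _)) = refl
    split∘join (inj₁ (e ∷ es , _ , e<N ∷ _ , _)) with e ≟ N
    ... | yes refl = ⊥-elim (<-irrefl refl e<N)
    ... | no _     = cong inj₁ (DistinctParts-≡ refl)
    split∘join (inj₂ _) with N ≟ N
    ... | yes refl = cong inj₂ (cong₂ _,_ (≤-irrelevant _ _) (DistinctParts-≡ refl))
    ... | no N≢N   = ⊥-elim (N≢N refl)

    join∘split : ∀ p → join (split p) ≡ p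
    join∘split ([] , _ , [] , _) = refl
    join∘split (e ∷ _ , _ , _ ∷ _ , _) with e ≟ N
    ... | yes refl = DistinctParts-≡ refl
    ... | no _     = DistinctParts-≡ refl

  DistinctParts-zero : ∀ {n} → ¬ DistinctParts zero (suc n)
  DistinctParts-zero ([] , _ , [] , ())

  distinctCount-↔ : ∀ N n → Fin (distinctCount N n) ↔ DistinctParts N n
  distinctCount-↔ zero zero = mk↔ₛ′ (λ _ → [] , [] , [] , refl) (λ _ → zero)
    (λ { ([] , [] , [] , refl) → refl }) (λ { zero → refl })
  distinctCount-↔ zero (suc n) =
    mk↔ₛ′ (λ ()) (⊥-elim ∘ DistinctParts-zero) (⊥-elim ∘ DistinctParts-zero) (λ ())
  distinctCount-↔ (suc N) n = ↔-trans +↔⊎ (↔-trans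
    (distinctCount-↔ N n ⊎-↔ Fin-if-↔ (w N ≤? n) ≤-irrelevant (distinctCount-↔ N (n ∸ w N)))
    (↔-sym (DistinctParts-suc-↔ N n)))

  prodTo-coeff : {F : ℕ → Series} → (∀ k → F k ≗ (λ j → one j ℤ.+ mono (w k) j)) →
                 ∀ N j → prodTo F N j ≡ + distinctCount N j
  prodTo-coeff F≗ zero    zero    = refl
  prodTo-coeff F≗ zero    (suc j) = refl
  prodTo-coeff {F} F≗ (suc N) j = begin
    (P ⊗ F N) j
      ≡⟨ ⊗-congʳ P (F≗ N) j ⟩
    (P ⊗ (λ i → one i ℤ.+ mono (w N) i)) j
      ≡⟨ ⊗-distribˡ-+ P one (mono (w N)) j ⟩
    (P ⊗ one) j ℤ.+ (P ⊗ mono (w N)) j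
      ≡⟨ cong₂ ℤ._+_ (trans (⊗-congʳ P one≗mono0 j) (⊗-mono P 0 j)) (⊗-mono P (w N) j) ⟩
    P j ℤ.+ (if? (w N ≤? j) then P (j ∸ w N) else 0ℤ)
      ≡⟨ cong₂ (λ x y → x ℤ.+ (if? (w N ≤? j) then y else 0ℤ))
               (prodTo-coeff F≗ N j) (prodTo-coeff F≗ N (j ∸ w N)) ⟩
    + distinctCount N j ℤ.+ (if? (w N ≤? j) then + distinctCount N (j ∸ w N) else 0ℤ)
      ≡⟨ cong (ℤ._+_ (+ distinctCount N j)) (sym (if?-float +_ (w N ≤? j) {y = 0})) ⟩
    + distinctCount (suc N) j ∎
    where open ≡-Reasoning
          P = prodTo F N

-- Staircases

addStaircase : List ℕ → List ℕ
addStaircase []       = []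
addStaircase (t ∷ ts) = t + length ts ∷ addStaircase ts

removeStaircase : List ℕ → List ℕ
removeStaircase []       = []
removeStaircase (e ∷ es) = e ∸ length es ∷ removeStaircase es

length-addStaircase : ∀ ts → length (addStaircase ts) ≡ length ts
length-addStaircase []       = refl
length-addStaircase (_ ∷ ts) = cong suc (length-addStaircase ts)

length-removeStaircase : ∀ es → length (removeStaircase es) ≡ length es
length-removeStaircase []       = refl
length-removeStaircase (_ ∷ es) = cong suc (length-removeStaircase es)

addStaircase-strict : ∀ {ts} → NonIncreasing ts → Strict (addStaircase ts)
addStaircase-strict []  = []
addStaircase-strict [-] = [-]
addStaircase-strict {t ∷ t′ ∷ ts} (t≥t′ ∷ l) =
  subst (t′ + length ts <_) (sym (+-suc t (length ts))) (s≤s (+-monoˡ-≤ (length ts) t≥t′))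
  ∷ addStaircase-strict l

removeStaircase-nonIncreasing : ∀ {es} → Strict es → NonIncreasing (removeStaircase es)
removeStaircase-nonIncreasing []  = []
removeStaircase-nonIncreasing [-] = [-]
removeStaircase-nonIncreasing {suc e ∷ e′ ∷ es} (s≤s e≥e′ ∷ l) =
  ∸-monoˡ-≤ (length es) e≥e′ ∷ removeStaircase-nonIncreasing l

removeStaircase-addStaircase : ∀ ts → removeStaircase (addStaircase ts) ≡ ts
removeStaircase-addStaircase []       = refl
removeStaircase-addStaircase (t ∷ ts) = cong₂ _∷_
  (trans (cong (t + length ts ∸_) (length-addStaircase ts)) (m+n∸n≡m t (length ts)))
  (removeStaircase-addStaircase ts)

addStaircase-removeStaircase : ∀ {es} → Strict es → addStaircase (removeStaircase es) ≡ es
addStaircase-removeStaircase {[]}     _      = refl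
addStaircase-removeStaircase {e ∷ es} strict = cong₂ _∷_
  (trans (cong (_+_ (e ∸ length es)) (length-removeStaircase es))
         (m∸n+n≡m (strict-length strict)))
  (addStaircase-removeStaircase (Linked.tail strict))

-- Self-conjugate copartitions

sum-replicate : ∀ k x → sum (replicate k x) ≡ k * x
sum-replicate zero    x = refl
sum-replicate (suc k) x = cong (_+_ x) (sum-replicate k x)

Linked-replicate : ∀ {A : Set} {R : A → A → Set} {x} → R x x → ∀ k → Linked R (replicate k x)
Linked-replicate r zero          = []
Linked-replicate r (suc zero)    = [-]
Linked-replicate r (suc (suc k)) = r ∷ Linked-replicate r (suc k)

module SelfConjugate (a m : ℕ) .{{_ : NonZero m}} (1≤a : 1 ≤ a) where

  open +-*-Solver
  open DistinctParts

  part : ℕ → ℕ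
  part t = a + m * t

  weight : ℕ → ℕ
  weight e = m + 2 * a + 2 * m * e

  symmetric : List ℕ → Triple
  symmetric γ = γ , replicate (length γ) (m * length γ) , γ

  selfConjugate⇒symmetric : ∀ {t} → conjugate m t ≡ t → symmetric (proj₁ t) ≡ t
  selfConjugate⇒symmetric refl = refl

  symmetric-ρ-partition : ∀ k → IsPartition (replicate k (m * k))
  symmetric-ρ-partition zero      = [] , []
  symmetric-ρ-partition k@(suc _) =
    Linked-replicate ≤-refl k , replicate⁺ k (>-nonZero⁻¹ (m * k) {{m*n≢0 m k}})

  size-symmetric : ∀ γ → size (symmetric γ) ≡ 2 * sum γ + m * (length γ * length γ)
  size-symmetric γ = begin
    sum γ + sum (replicate k (m * k)) + sum γ
      ≡⟨ cong (λ x → sum γ + x + sum γ) (sum-replicate k (m * k)) ⟩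
    sum γ + k * (m * k) + sum γ
      ≡⟨ solve 3 (λ S K M → S :+ K :* (M :* K) :+ S := con 2 :* S :+ M :* (K :* K)) refl (sum γ) k m ⟩
    2 * sum γ + m * (k * k) ∎
    where open ≡-Reasoning
          k = length γ

  sum-weight-addStaircase : ∀ ts → sum (map weight (addStaircase ts)) ≡
                                   2 * sum (map part ts) + m * (length ts * length ts)
  sum-weight-addStaircase []       = sym (*-zeroʳ m)
  sum-weight-addStaircase (t ∷ ts) = begin
    weight (t + k) + sum (map weight (addStaircase ts))
      ≡⟨ cong (_+_ (weight (t + k))) (sum-weight-addStaircase ts) ⟩
    weight (t + k) + (2 * S + m * (k * k))
      ≡⟨ solve 5 (λ A M T K S′ →
                    M :+ con 2 :* A :+ con 2 :* M :* (T :+ K) :+ (con 2 :* S′ :+ M :* (K :* K))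
                    := con 2 :* (A :+ M :* T :+ S′) :+ M :* ((con 1 :+ K) :* (con 1 :+ K)))
                 refl a m t k S ⟩
    2 * (part t + S) + m * (suc k * suc k) ∎
    where open ≡-Reasoning
          k = length ts
          S = sum (map part ts)

  size-symmetric-parts : ∀ ts → size (symmetric (map part ts)) ≡ sum (map weight (addStaircase ts))
  size-symmetric-parts ts = begin
    size (symmetric (map part ts))
      ≡⟨ size-symmetric (map part ts) ⟩
    2 * sum (map part ts) + m * (length (map part ts) * length (map part ts))
      ≡⟨ cong (λ k → 2 * sum (map part ts) + m * (k * k)) (Listₚ.length-map part ts) ⟩
    2 * sum (map part ts) + m * (length ts * length ts)
      ≡⟨ sym (sum-weight-addStaircase ts) ⟩
    sum (map weight (addStaircase ts)) ∎
    where open ≡-Reasoning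

  ≤-weight : ∀ e → e ≤ weight e
  ≤-weight e = ≤-trans (m≤n*m e (2 * m) {{m*n≢0 2 m}}) (m≤n+m (2 * m * e) (m + 2 * a))

  PartOk-part : ∀ t → PartOk a m (part t)
  PartOk-part t = m≤m+n a (m * t) , divides t (trans (m+n∸m≡n a (m * t)) (*-comm m t))

  part-quotient : ∀ {x} (ok : PartOk a m x) → part (_∣_.quotient (proj₂ ok)) ≡ x
  part-quotient {x} (a≤x , divides t x∸a≡t*m) = begin
    a + m * t     ≡⟨ cong (_+_ a) (trans (*-comm m t) (sym x∸a≡t*m)) ⟩
    a + (x ∸ a)   ≡⟨ m+[n∸m]≡n a≤x ⟩
    x             ∎
    where open ≡-Reasoning

  quotients : ∀ {γ} → All (PartOk a m) γ → List ℕ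
  quotients = All.reduce (_∣_.quotient ∘ proj₂)

  map-part-quotients : ∀ {γ} (ok : All (PartOk a m) γ) → map part (quotients ok) ≡ γ
  map-part-quotients []        = refl
  map-part-quotients (p ∷ ok) = cong₂ _∷_ (part-quotient p) (map-part-quotients ok)

  All-PartOk-parts : ∀ ts → All (PartOk a m) (map part ts)
  All-PartOk-parts []       = []
  All-PartOk-parts (t ∷ ts) = PartOk-part t ∷ All-PartOk-parts ts

  quotients-parts : ∀ ts → quotients (All-PartOk-parts ts) ≡ ts
  quotients-parts []       = refl
  quotients-parts (t ∷ ts) = cong (t ∷_) (quotients-parts ts)

  parts-nonIncreasing : ∀ {ts} → NonIncreasing ts → NonIncreasing (map part ts)
  parts-nonIncreasing l = map⁺ (Linked.map (+-monoʳ-≤ a ∘ *-monoʳ-≤ m) l)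

  parts-nonIncreasing⁻ : ∀ {ts} → NonIncreasing (map part ts) → NonIncreasing ts
  parts-nonIncreasing⁻ l = Linked.map (*-cancelˡ-≤ m ∘ +-cancelˡ-≤ a _ _) (map⁻ l)

  parts-IsPartition : ∀ {ts} → NonIncreasing ts → IsPartition (map part ts)
  parts-IsPartition {ts} l =
    parts-nonIncreasing l , All.map (λ ok → ≤-trans 1≤a (proj₁ ok)) (All-PartOk-parts ts)

  ResiduePartitions : ℕ → Set
  ResiduePartitions n =
    Σ (List ℕ) λ γ → IsPartition γ × All (PartOk a m) γ × size (symmetric γ) ≡ n

  ResiduePartitions-≡ : ∀ {n} {p q : ResiduePartitions n} → proj₁ p ≡ proj₁ q → p ≡ q
  ResiduePartitions-≡ = Σ-≡-proj₁ λ _ →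
    IsPartition-irrelevant ×-irrelevant All.irrelevant PartOk-irrelevant ×-irrelevant ≡-irrelevant

  QuotientLists : ℕ → Set
  QuotientLists n = Σ (List ℕ) λ ts → NonIncreasing ts × size (symmetric (map part ts)) ≡ n

  QuotientLists-≡ : ∀ {n} {p q : QuotientLists n} → proj₁ p ≡ proj₁ q → p ≡ q
  QuotientLists-≡ = Σ-≡-proj₁ λ _ → Linked.irrelevant ≤-irrelevant ×-irrelevant ≡-irrelevant

  SCP-↔ : ∀ n → ResiduePartitions n ↔ SCP a m n
  SCP-↔ n = mk↔ₛ′ to from to∘from from∘to
    where
    to : ResiduePartitions n → SCP a m n
    to (γ , γ-part , ok , size≡n) = symmetric γ ,
      (γ-part , symmetric-ρ-partition (length γ) , γ-part , ok , ok , refl) , refl , size≡n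
    from : SCP a m n → ResiduePartitions n
    from ((γ , _ , _) , (γ-part , _ , _ , ok , _ , _) , self , size≡n) =
      γ , γ-part , ok , trans (cong size (selfConjugate⇒symmetric self)) size≡n
    to∘from : ∀ s → to (from s) ≡ s
    to∘from (_ , _ , self , _) = Σ-≡-proj₁
      (λ t → IsCopartition-irrelevant t ×-irrelevant Triple-≡-irrelevant ×-irrelevant ≡-irrelevant)
      (selfConjugate⇒symmetric self)
    from∘to : ∀ p → from (to p) ≡ p
    from∘to _ = ResiduePartitions-≡ refl

  quotients-↔ : ∀ n → QuotientLists n ↔ ResiduePartitions n
  quotients-↔ n = mk↔ₛ′ to from to∘from from∘to
    where
    to : QuotientLists n → ResiduePartitions n
    to (ts , l , size≡n) = map part ts , parts-IsPartition l , All-PartOk-parts ts , size≡n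
    from : ResiduePartitions n → QuotientLists n
    from (γ , (l , _) , ok , size≡n) = quotients ok ,
      parts-nonIncreasing⁻ (subst (NonIncreasing) (sym (map-part-quotients ok)) l) ,
      subst (λ γ′ → size (symmetric γ′) ≡ n) (sym (map-part-quotients ok)) size≡n
    to∘from : ∀ p → to (from p) ≡ p
    to∘from (_ , _ , ok , _) = ResiduePartitions-≡ (map-part-quotients ok)
    from∘to : ∀ q → from (to q) ≡ q
    from∘to (ts , _) = QuotientLists-≡ (quotients-parts ts)

  staircase-↔ : ∀ n → QuotientLists n ↔ DistinctParts weight (suc n) n
  staircase-↔ n = mk↔ₛ′ to from to∘from from∘to
    where
    to : QuotientLists n → DistinctParts weight (suc n) n
    to (ts , l , size≡n) = addStaircase ts , addStaircase-strict l ,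
      All.map (λ {e} e≤Σ → s≤s (≤-trans (≤-weight e) (subst (weight e ≤_) Σ≡n e≤Σ)))
              (All-≤-sum-map weight (addStaircase ts)) ,
      Σ≡n
      where Σ≡n = trans (sym (size-symmetric-parts ts)) size≡n
    from : DistinctParts weight (suc n) n → QuotientLists n
    from (es , strict , _ , Σ≡n) = removeStaircase es , removeStaircase-nonIncreasing strict ,
      trans (size-symmetric-parts (removeStaircase es))
            (trans (cong (sum ∘ map weight) (addStaircase-removeStaircase strict)) Σ≡n)
    to∘from : ∀ p → to (from p) ≡ p
    to∘from (_ , strict , _) = DistinctParts-≡ weight (addStaircase-removeStaircase strict)
    from∘to : ∀ q → from (to q) ≡ q
    from∘to (ts , _) = QuotientLists-≡ (removeStaircase-addStaircase ts)

theorem3p3 : (a m : ℕ) → 1 ≤ a → 1 ≤ m → (n : ℕ) →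
    Σ ℕ (λ c → (Fin c ↔ SCP a m n) ×
    (+ c ≡ poch∞ (neg (mono (m + 2 * a))) (mono (2 * m)) n))
theorem3p3 _ zero      _   ()        _
theorem3p3 a m@(suc _) 1≤a (s≤s z≤n) n =
  distinctCount weight (suc n) n ,
  ↔-trans (distinctCount-↔ weight (suc n) n)
    (↔-trans (↔-sym (staircase-↔ n)) (↔-trans (quotients-↔ n) (SCP-↔ n))) ,
  sym (prodTo-coeff weight (factor-coeff (m + 2 * a) (2 * m)) (suc n) n)
  where open SelfConjugate a m 1≤a
        open DistinctParts
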